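{- Let $n=p_1^{\alpha_1}p_2^{\alpha_2}\cdots p_k^{\alpha_k}$ be the prime power factorization of a composite integer $n$ (distinct primes $p_i$), with $\alpha_1\ge3$ if $k=1$. Then: (i) if $k=1$ and $\alpha_1\in\{3,4\}$, then $p_1$ and $p_1^2$ are the pendant vertices of $\Upsilon_n$; (ii) if $k=1$ and $\alpha_1\ge5$, then $p_1$ is the only pendant vertex of $\Upsilon_n$; (iii) if $k\ge2$, then $p_1,p_2,\dots,p_k$ are precisely the pendant vertices of $\Upsilon_n$.
   Context: For an integer $n>1$, a proper divisor of $n$ is an integer $d$ with $1<d<n$ and $d\mid n$. The proper divisor graph $\Upsilon_n$ is the simple graph whose vertices are the proper divisors of $n$, two distinct vertices $u,v$ being adjacent iff $n\mid uv$. A pendant vertex is a vertex of degree one. -}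

module Defs where

open import Data.Nat using (ℕ; _*_; _<_; _<?_; _≟_)
open import Data.Nat.Divisibility using (_∣_; _∣?_)
open import Data.List using (List; upTo; filter; length)
open import Data.Product using (_×_)
open import Relation.Nullary using (¬_; Dec)
open import Relation.Nullary.Decidable using (_×-dec_; ¬?)
open import Relation.Binary.PropositionalEquality using (_≡_; _≢_)

ProperDivisor : ℕ → ℕ → Set
ProperDivisor n d = 1 < d × d < n × d ∣ n

properDivisor? : (n d : ℕ) → Dec (ProperDivisor n d)
properDivisor? n d = (1 <? d) ×-dec ((d <? n) ×-dec (d ∣? n))

vertices : ℕ → List ℕ
vertices n = filter (properDivisor? n) (upTo n)

Adjacent : ℕ → ℕ → ℕ → Set
Adjacent n u v = u ≢ v × n ∣ u * v

adjacent? : (n u v : ℕ) → Dec (Adjacent n u v)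
adjacent? n u v = ¬? (u ≟ v) ×-dec (n ∣? u * v)

degree : ℕ → ℕ → ℕ
degree n u = length (filter (adjacent? n u) (vertices n))

IsPendant : ℕ → ℕ → Set
IsPendant n u = ProperDivisor n u × degree n u ≡ 1

-- For n = p^α the vertices are p^i (0 < i < α), and p^j is a neighbour of p^i
-- iff j ≠ i and i + j ≥ α: the exponent 1 has the single neighbour α - 1, while
-- an exponent i ≥ 2 has the neighbours α - 1, α - 2 and, when i ≥ 3, α - 3, at
-- least two of which differ from i unless α ≤ 4.
-- For any other n > 1 and a proper divisor d = n / m, the vertices m t with
-- t ∣ d, t < d, m t ≠ d are neighbours of d.  For prime d these are all of them,
-- only t = 1 occurs, and m ≠ d because n is not the square of a prime.  For
-- composite d with a prime factor r, two of t ∈ {1, r, d / r} qualify unless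
-- n = r³ or n = r⁴.
module Submission where

open import Defs
open import Data.Nat using (ℕ; _^_; _≤_; _<_)
open import Data.Nat.Divisibility using (_∣_)
open import Data.Nat.Primality using (Prime)
open import Data.Product using (_×_; Σ-syntax)
open import Data.Sum using (_⊎_)
open import Function.Bundles using (_⇔_)
open import Relation.Binary.PropositionalEquality using (_≡_; _≢_)

open import Data.List using (List; []; _∷_; length; filter; upTo)
open import Data.List.Membership.Propositional using (_∈_)
open import Data.List.Membership.Propositional.Properties
  using (∈-filter⁺; ∈-filter⁻; ∈-upTo⁺)
open import Data.List.Relation.Unary.All using (_∷_)
open import Data.List.Relation.Unary.AllPairs using (_∷_)
open import Data.List.Relation.Unary.Any using (here; there)
open import Data.List.Relation.Unary.Unique.Propositional using (Unique)
import Data.List.Relation.Unary.Unique.Propositional.Properties as Unique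
open import Data.Nat
  using (zero; suc; _*_; _+_; _∸_; _≟_; NonZero; z≤n; s≤s; z<s; s≤s⁻¹; >-nonZero; ≢-nonZero; ≢-nonZero⁻¹; nonTrivial⇒n>1; n>1⇒nonTrivial)
import Data.Nat.Coprimality as Coprimality
open import Data.Nat.Divisibility
  using (divides; quotient; 1∣_; *-cancelʳ-∣; ∣-trans; ∣-reflexive; _∣?_; ∣⇒≤; ∣1⇒≡1; 0∣⇒≡0; m∣m*n
        ; *-monoʳ-∣; *-cancelˡ-∣; m∣n⇒n≡quotient*m; m∣n⇒n≡m*quotient; quotient-∣; quotient>1; quotient-<)
open import Data.Nat.Primality
  using (prime?; ¬prime[1]; prime⇒irreducible; prime⇒nonTrivial; prime⇒nonZero)
open import Data.Nat.Primality.Factorisation using (factorise)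
open import Data.Nat.Properties
open import Data.Product using (_,_; proj₁; proj₂; ∃-syntax)
open import Data.Sum using (inj₁; inj₂)
open import Function.Bundles using (mk⇔)
open import Relation.Binary.PropositionalEquality using (refl; sym; trans; cong; cong₂; subst; subst₂; module ≡-Reasoning)
open import Relation.Nullary using (¬_; Dec; yes; no; contradiction)

private
  variable
    n u v w d p i j k α : ℕ
    xs : List ℕ
    x y : ℕ

unique∧all≡⇒length≡1 : Unique xs → x ∈ xs → (∀ {y} → y ∈ xs → y ≡ x) → length xs ≡ 1
unique∧all≡⇒length≡1 {a ∷ []} _ _ _ = refl
unique∧all≡⇒length≡1 {a ∷ b ∷ _} ((a≢b ∷ _) ∷ _) _ all≡ =
  contradiction (trans (all≡ (here refl)) (sym (all≡ (there (here refl))))) a≢b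

distinct∈⇒length≢1 : x ∈ xs → y ∈ xs → x ≢ y → length xs ≢ 1
distinct∈⇒length≢1 {xs = _ ∷ []} (here refl) (here refl) x≢y _ = x≢y refl
distinct∈⇒length≢1 {xs = _ ∷ _ ∷ _} _ _ _ ()

neighbours : ℕ → ℕ → List ℕ
neighbours n u = filter (adjacent? n u) (vertices n)

∈-neighbours⁺ : ProperDivisor n v → Adjacent n u v → v ∈ neighbours n u
∈-neighbours⁺ {n} {u = u} v-vertex u~v =
  ∈-filter⁺ (adjacent? n u) (∈-filter⁺ (properDivisor? n) (∈-upTo⁺ (proj₁ (proj₂ v-vertex))) v-vertex) u~v

∈-neighbours⁻ : v ∈ neighbours n u → ProperDivisor n v × Adjacent n u v
∈-neighbours⁻ {n = n} {u} v∈ with ∈-filter⁻ (adjacent? n u) {xs = vertices n} v∈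
... | v∈vertices , u~v = proj₂ (∈-filter⁻ (properDivisor? n) {xs = upTo n} v∈vertices) , u~v

neighbours-unique : ∀ n u → Unique (neighbours n u)
neighbours-unique n u = Unique.filter⁺ (adjacent? n u) (Unique.filter⁺ (properDivisor? n) (Unique.upTo⁺ n))

isPendant⁺ : ProperDivisor n u → ProperDivisor n v → Adjacent n u v →
             (∀ w → ProperDivisor n w → Adjacent n u w → w ≡ v) → IsPendant n u
isPendant⁺ {n} {u} u-vertex v-vertex u~v unique =
  u-vertex , unique∧all≡⇒length≡1 (neighbours-unique n u) (∈-neighbours⁺ v-vertex u~v)
               (λ w∈ → let w-vertex , u~w = ∈-neighbours⁻ w∈ in unique _ w-vertex u~w)

¬isPendant : ProperDivisor n v → Adjacent n u v → ProperDivisor n w → Adjacent n u w →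
             v ≢ w → ¬ IsPendant n u
¬isPendant v-vertex u~v w-vertex u~w v≢w (_ , degree≡1) =
  distinct∈⇒length≢1 (∈-neighbours⁺ v-vertex u~v) (∈-neighbours⁺ w-vertex u~w) v≢w degree≡1

prime⇒>1 : Prime p → 1 < p
prime⇒>1 {p} p-prime = nonTrivial⇒n>1 p {{prime⇒nonTrivial p-prime}}

prime∣prime⇒≡ : ∀ {q} → Prime p → Prime q → p ∣ q → p ≡ q
prime∣prime⇒≡ p-prime q-prime p∣q with prime⇒irreducible q-prime p∣q
... | inj₁ refl = contradiction p-prime ¬prime[1]
... | inj₂ p≡q  = p≡q

primeDivisor : 1 < n → ∃[ r ] Prime r × r ∣ n
primeDivisor {n} 1<n with factorise n {{>-nonZero (<-trans z<s 1<n)}}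
... | record { factors = [] ; isFactorisation = n≡1 } = contradiction n≡1 (>⇒≢ 1<n)
... | record { factors = r ∷ rs ; isFactorisation = n≡r*rs ; factorsPrime = r-prime ∷ _ } =
  r , r-prime , subst (r ∣_) (sym n≡r*rs) (m∣m*n _)

∣p^⇒≡p^ : ∀ α → Prime p → d ∣ p ^ α → ∃[ j ] d ≡ p ^ j
∣p^⇒≡p^ zero _ d∣1 = 0 , ∣1⇒≡1 d∣1
∣p^⇒≡p^ {p} {d} (suc α) p-prime d∣p^1+α with p ∣? d
... | yes (divides e refl)
  with ∣p^⇒≡p^ α p-prime (*-cancelˡ-∣ p {{prime⇒nonZero p-prime}} (subst (_∣ p ^ suc α) (*-comm e p) d∣p^1+α))
... | j , refl = suc j , *-comm (p ^ j) p
∣p^⇒≡p^ {p} {d} (suc α) p-prime d∣p^1+α | no p∤d =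
  ∣p^⇒≡p^ α p-prime (Coprimality.coprime-divisor (Coprimality.sym p⊥d) d∣p^1+α)
  where
  p⊥d : Coprimality.Coprime p d
  p⊥d (c∣p , c∣d) with prime⇒irreducible p-prime c∣p
  ... | inj₁ c≡1 = c≡1
  ... | inj₂ refl = contradiction c∣d p∤d

IsPrimePower : ℕ → Set
IsPrimePower n = ∃[ r ] ∃[ k ] Prime r × n ≡ r ^ k

prime∣p^⇒≡ : ∀ {s} k → Prime p → Prime s → s ∣ p ^ k → s ≡ p
prime∣p^⇒≡ {p} k p-prime s-prime s∣p^k with ∣p^⇒≡p^ k p-prime s∣p^k
... | zero  , refl = contradiction s-prime ¬prime[1]
... | suc j , refl = sym (prime∣prime⇒≡ p-prime s-prime (m∣m*n (p ^ j)))

distinctPrimeDivisors⇒¬IsPrimePower : ∀ {q} → Prime p → Prime q → p ≢ q → p ∣ n → q ∣ n → ¬ IsPrimePower n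
distinctPrimeDivisors⇒¬IsPrimePower p-prime q-prime p≢q p∣n q∣n (r , k , r-prime , refl) =
  p≢q (trans (prime∣p^⇒≡ k r-prime p-prime p∣n) (sym (prime∣p^⇒≡ k r-prime q-prime q∣n)))

square≡^2 : ∀ r → r * r ≡ r ^ 2
square≡^2 r = cong (r *_) (sym (*-identityʳ r))

module _ {p} (1<p : 1 < p) where

  private instance
    p≢0 : NonZero p
    p≢0 = >-nonZero (<-trans z<s 1<p)

  ^-cancelˡ-< : p ^ i < p ^ j → i < j
  ^-cancelˡ-< p^i<p^j = ≰⇒> (λ j≤i → <⇒≱ p^i<p^j (^-monoʳ-≤ p j≤i))

  ^-cancelˡ-≤ : p ^ i ≤ p ^ j → i ≤ j
  ^-cancelˡ-≤ p^i≤p^j = ≮⇒≥ (λ j<i → <⇒≱ (^-monoʳ-< p 1<p j<i) p^i≤p^j)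

  ^-injectiveʳ : p ^ i ≡ p ^ j → i ≡ j
  ^-injectiveʳ p^i≡p^j = ≤-antisym (^-cancelˡ-≤ (≤-reflexive p^i≡p^j)) (^-cancelˡ-≤ (≤-reflexive (sym p^i≡p^j)))

  ^-cancelˡ-∣ : p ^ i ∣ p ^ j → i ≤ j
  ^-cancelˡ-∣ {j = j} p^i∣p^j = ^-cancelˡ-≤ (∣⇒≤ {{m^n≢0 p j}} p^i∣p^j)

^-monoʳ-∣ : ∀ p → i ≤ j → p ^ i ∣ p ^ j
^-monoʳ-∣ {i} {j} p i≤j =
  divides (p ^ (j ∸ i)) (trans (cong (p ^_) (sym (m∸n+n≡m i≤j))) (^-distribˡ-+-* p (j ∸ i) i))

-- Υ of a prime power

NeighbourExponent : (α i j : ℕ) → Set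
NeighbourExponent α i j = 0 < j × j < α × i ≢ j × α ≤ i + j

neighbourExponent-+ : ∀ t → 0 < t → 0 < j → t ≤ i → i ≢ j → NeighbourExponent (t + j) i j
neighbourExponent-+ {j} t 0<t 0<j t≤i i≢j = 0<j , m<n+m j 0<t , i≢j , +-monoˡ-≤ j t≤i

neighbourExponent-1 : ∀ a → NeighbourExponent (suc a) 1 k → k ≡ a
neighbourExponent-1 a (_ , k<1+a , _ , 1+a≤1+k) = ≤-antisym (s≤s⁻¹ k<1+a) (s≤s⁻¹ 1+a≤1+k)

module PrimePower {p} (p-prime : Prime p) (α : ℕ) where

  private
    1<p : 1 < p
    1<p = prime⇒>1 p-prime

  properDivisor-p^ : 0 < i → i < α → ProperDivisor (p ^ α) (p ^ i)
  properDivisor-p^ 0<i i<α = ^-monoʳ-< p 1<p 0<i , ^-monoʳ-< p 1<p i<α , ^-monoʳ-∣ p (<⇒≤ i<α)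

  properDivisor-p^⁻ : ProperDivisor (p ^ α) d → ∃[ i ] 0 < i × i < α × d ≡ p ^ i
  properDivisor-p^⁻ (1<d , d<p^α , d∣p^α) with ∣p^⇒≡p^ α p-prime d∣p^α
  ... | i , refl = i , ^-cancelˡ-< 1<p 1<d , ^-cancelˡ-< 1<p d<p^α , refl

  adjacent-p^ : i ≢ j → α ≤ i + j → Adjacent (p ^ α) (p ^ i) (p ^ j)
  adjacent-p^ {i} {j} i≢j α≤i+j =
    (λ p^i≡p^j → i≢j (^-injectiveʳ 1<p p^i≡p^j)) , subst (p ^ α ∣_) (^-distribˡ-+-* p i j) (^-monoʳ-∣ p α≤i+j)

  adjacent-p^⁻ : ∀ i j → Adjacent (p ^ α) (p ^ i) (p ^ j) → α ≤ i + j
  adjacent-p^⁻ i j (_ , p^α∣p^i*p^j) = ^-cancelˡ-∣ 1<p (subst (p ^ α ∣_) (sym (^-distribˡ-+-* p i j)) p^α∣p^i*p^j)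

  p^-isPendant : 0 < i → i < α → NeighbourExponent α i j → (∀ k → NeighbourExponent α i k → k ≡ j) →
                 IsPendant (p ^ α) (p ^ i)
  p^-isPendant {i} {j} 0<i i<α (0<j , j<α , i≢j , α≤i+j) unique =
    isPendant⁺ (properDivisor-p^ 0<i i<α) (properDivisor-p^ 0<j j<α) (adjacent-p^ i≢j α≤i+j) unique-p^
    where
    unique-p^ : ∀ w → ProperDivisor (p ^ α) w → Adjacent (p ^ α) (p ^ i) w → w ≡ p ^ j
    unique-p^ w w-vertex i~w with properDivisor-p^⁻ w-vertex
    ... | k , 0<k , k<α , refl =
      cong (p ^_) (unique k (0<k , k<α , (λ i≡k → proj₁ i~w (cong (p ^_) i≡k)) , adjacent-p^⁻ i k i~w))

  p^-¬isPendant : NeighbourExponent α i j → NeighbourExponent α i k → j ≢ k → ¬ IsPendant (p ^ α) (p ^ i)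
  p^-¬isPendant (0<j , j<α , i≢j , α≤i+j) (0<k , k<α , i≢k , α≤i+k) j≢k =
    ¬isPendant (properDivisor-p^ 0<j j<α) (adjacent-p^ i≢j α≤i+j)
               (properDivisor-p^ 0<k k<α) (adjacent-p^ i≢k α≤i+k)
               (λ p^j≡p^k → j≢k (^-injectiveʳ 1<p p^j≡p^k))

p-isPendant : ∀ α → Prime p → 2 < α → IsPendant (p ^ α) p
p-isPendant {p} (suc a) p-prime (s≤s 1<a) =
  subst (IsPendant (p ^ suc a)) (^-identityʳ p)
    (p^-isPendant z<s (s≤s 0<a) (neighbourExponent-+ 1 z<s 0<a ≤-refl (<⇒≢ 1<a)) (λ k → neighbourExponent-1 a))
  where
  open PrimePower p-prime (suc a)
  0<a = <-trans z<s 1<a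

pendants-p^3 : Prime p → IsPendant (p ^ 3) d ⇔ (d ≡ p ⊎ d ≡ p ^ 2)
pendants-p^3 {p} {d} p-prime = mk⇔ to from
  where
  open PrimePower p-prime 3

  to : IsPendant (p ^ 3) d → d ≡ p ⊎ d ≡ p ^ 2
  to (d-vertex , _) with properDivisor-p^⁻ d-vertex
  ... | 1 , _ , _ , refl = inj₁ (^-identityʳ p)
  ... | 2 , _ , _ , refl = inj₂ refl
  ... | suc (suc (suc _)) , _ , s≤s (s≤s (s≤s ())) , _

  unique-2 : ∀ k → NeighbourExponent 3 2 k → k ≡ 1
  unique-2 1 _ = refl
  unique-2 2 (_ , _ , 2≢2 , _) = contradiction refl 2≢2
  unique-2 (suc (suc (suc _))) (_ , s≤s (s≤s (s≤s ())) , _)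

  from : d ≡ p ⊎ d ≡ p ^ 2 → IsPendant (p ^ 3) d
  from (inj₁ refl) = p-isPendant 3 p-prime (s≤s (s≤s (s≤s z≤n)))
  from (inj₂ refl) = p^-isPendant z<s (s≤s (s≤s (s≤s z≤n))) (neighbourExponent-+ 2 z<s z<s ≤-refl λ ()) unique-2

pendants-p^4 : Prime p → IsPendant (p ^ 4) d ⇔ (d ≡ p ⊎ d ≡ p ^ 2)
pendants-p^4 {p} {d} p-prime = mk⇔ to from
  where
  open PrimePower p-prime 4

  to : IsPendant (p ^ 4) d → d ≡ p ⊎ d ≡ p ^ 2
  to (d-vertex , degree≡1) with properDivisor-p^⁻ d-vertex
  ... | 1 , _ , _ , refl = inj₁ (^-identityʳ p)
  ... | 2 , _ , _ , refl = inj₂ refl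
  ... | 3 , _ , _ , refl =
    contradiction (d-vertex , degree≡1)
      (p^-¬isPendant (neighbourExponent-+ 3 z<s z<s ≤-refl λ ()) (neighbourExponent-+ 2 z<s z<s (s≤s (s≤s z≤n)) λ ()) λ ())
  ... | suc (suc (suc (suc _))) , _ , s≤s (s≤s (s≤s (s≤s ()))) , _

  unique-2 : ∀ k → NeighbourExponent 4 2 k → k ≡ 3
  unique-2 1 (_ , _ , _ , s≤s (s≤s (s≤s ())))
  unique-2 2 (_ , _ , 2≢2 , _) = contradiction refl 2≢2
  unique-2 3 _ = refl
  unique-2 (suc (suc (suc (suc _)))) (_ , s≤s (s≤s (s≤s (s≤s ()))) , _)

  from : d ≡ p ⊎ d ≡ p ^ 2 → IsPendant (p ^ 4) d
  from (inj₁ refl) = p-isPendant 4 p-prime (s≤s (s≤s (s≤s z≤n)))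
  from (inj₂ refl) = p^-isPendant z<s (s≤s (s≤s (s≤s z≤n))) (neighbourExponent-+ 1 z<s z<s (s≤s z≤n) λ ()) unique-2

+-congʳ-≢ : ∀ c {a b} → a ≢ b → a + c ≢ b + c
+-congʳ-≢ c {a} {b} a≢b a+c≡b+c = a≢b (+-cancelʳ-≡ c a b a+c≡b+c)

neighbourExponents-≥2 : ∀ β i → 2 ≤ i →
  ∃[ j ] ∃[ k ] NeighbourExponent (5 + β) i j × NeighbourExponent (5 + β) i k × j ≢ k
neighbourExponents-≥2 β i 2≤i with i ≟ 4 + β | i ≟ 3 + β
... | yes refl | _ =
  3 + β , 2 + β ,
  neighbourExponent-+ 2 z<s z<s 2≤i (+-congʳ-≢ β λ ()) , neighbourExponent-+ 3 z<s z<s (s≤s (s≤s (s≤s z≤n))) (+-congʳ-≢ β λ ()) ,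
  +-congʳ-≢ β λ ()
... | no _ | yes refl =
  4 + β , 2 + β ,
  neighbourExponent-+ 1 z<s z<s (<⇒≤ 2≤i) (+-congʳ-≢ β λ ()) , neighbourExponent-+ 3 z<s z<s (s≤s (s≤s (s≤s z≤n))) (+-congʳ-≢ β λ ()) ,
  +-congʳ-≢ β λ ()
... | no i≢4+β | no i≢3+β =
  4 + β , 3 + β ,
  neighbourExponent-+ 1 z<s z<s (<⇒≤ 2≤i) i≢4+β , neighbourExponent-+ 2 z<s z<s 2≤i i≢3+β ,
  +-congʳ-≢ β λ ()

pendants-p^≥5 : Prime p → 5 ≤ α → IsPendant (p ^ α) d ⇔ d ≡ p
pendants-p^≥5 {p} {d = d} p-prime (s≤s (s≤s (s≤s (s≤s (s≤s {n = β} z≤n))))) = mk⇔ to from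
  where
  open PrimePower p-prime (5 + β)

  to : IsPendant (p ^ (5 + β)) d → d ≡ p
  to (d-vertex , degree≡1) with properDivisor-p^⁻ d-vertex
  ... | 1 , _ , _ , refl = ^-identityʳ p
  ... | suc (suc i) , _ , _ , refl with neighbourExponents-≥2 β (suc (suc i)) (s≤s (s≤s z≤n))
  ... | j , k , i~j , i~k , j≢k = contradiction (d-vertex , degree≡1) (p^-¬isPendant i~j i~k j≢k)

  from : d ≡ p → IsPendant (p ^ (5 + β)) d
  from refl = p-isPendant (5 + β) p-prime (s≤s (s≤s (s≤s z≤n)))

-- Υ of a number that is not a prime power

-- t stands for the vertex m * t, where n = m * d.
NeighbourFactor : (m d t : ℕ) → Set
NeighbourFactor m d t = t ∣ d × t < d × m * t ≢ d

module Cofactor {n d} (d-vertex : ProperDivisor n d) where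

  private
    1<d : 1 < d
    1<d = proj₁ d-vertex
    d<n : d < n
    d<n = proj₁ (proj₂ d-vertex)
    d∣n : d ∣ n
    d∣n = proj₂ (proj₂ d-vertex)

  m : ℕ
  m = quotient d∣n

  private
    n≡m*d : n ≡ m * d
    n≡m*d = m∣n⇒n≡quotient*m d∣n
    n≡d*m : n ≡ d * m
    n≡d*m = m∣n⇒n≡m*quotient d∣n
    1<m : 1 < m
    1<m = quotient>1 d∣n d<n
    instance
      d≢0 : NonZero d
      d≢0 = >-nonZero (<-trans z<s 1<d)
      m≢0 : NonZero m
      m≢0 = >-nonZero (<-trans z<s 1<m)

  neighbourFactor⇒neighbour : ∀ {t} → NeighbourFactor m d t → ProperDivisor n (m * t) × Adjacent n d (m * t)
  neighbourFactor⇒neighbour {t} (t∣d , t<d , m*t≢d) =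
    (<-≤-trans 1<m (m≤m*n m t {{t≢0}}) , subst (m * t <_) (sym n≡m*d) (*-monoʳ-< m t<d) ,
     subst (m * t ∣_) (sym n≡m*d) (*-monoʳ-∣ m t∣d)) ,
    (λ d≡m*t → m*t≢d (sym d≡m*t)) , subst (n ∣_) (*-assoc d m t) (∣-trans (∣-reflexive n≡d*m) (m∣m*n t))
    where
    t≢0 : NonZero t
    t≢0 = ≢-nonZero λ { refl → ≢-nonZero⁻¹ d (0∣⇒≡0 t∣d) }

  neighbourFactors⇒¬isPendant : ∀ {s t} → NeighbourFactor m d s → NeighbourFactor m d t → s ≢ t → ¬ IsPendant n d
  neighbourFactors⇒¬isPendant {s} {t} s-factor t-factor s≢t =
    ¬isPendant (proj₁ ms) (proj₂ ms) (proj₁ mt) (proj₂ mt) (λ m*s≡m*t → s≢t (*-cancelˡ-≡ s t m m*s≡m*t))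
    where
    ms = neighbourFactor⇒neighbour s-factor
    mt = neighbourFactor⇒neighbour t-factor

  prime-isPendant : Prime d → n ≢ d * d → IsPendant n d
  prime-isPendant d-prime n≢d*d = isPendant⁺ d-vertex (proj₁ m*1) (proj₂ m*1) unique
    where
    m*1 = neighbourFactor⇒neighbour (1∣ d , 1<d , λ m*1≡d → n≢d*d (trans n≡m*d (cong (_* d) (trans (sym (*-identityʳ m)) m*1≡d))))
    unique : ∀ w → ProperDivisor n w → Adjacent n d w → w ≡ m * 1
    unique w (_ , w<n , w∣n) (_ , n∣d*w) with *-cancelˡ-∣ d (subst (_∣ d * w) n≡d*m n∣d*w)
    ... | divides t w≡t*m with prime⇒irreducible d-prime (*-cancelʳ-∣ {t} {d} m (subst₂ _∣_ w≡t*m n≡d*m w∣n))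
    ...   | inj₁ refl = trans w≡t*m (*-comm 1 m)
    ...   | inj₂ refl = contradiction (trans w≡t*m (sym n≡d*m)) (<⇒≢ w<n)

  squareOfPrime-cofactor : ∀ {r} → ¬ IsPrimePower n → Prime r → d ≡ r * r → m ≢ d × m ≢ r
  squareOfPrime-cofactor {r} ¬primePower r-prime d≡r*r = m≢d , m≢r
    where
    open ≡-Reasoning
    d≡r^2 = trans d≡r*r (square≡^2 r)
    m≢d : m ≢ d
    m≢d m≡d = ¬primePower (r , 4 , r-prime , (begin
      n              ≡⟨ n≡m*d ⟩
      m * d          ≡⟨ cong₂ _*_ (trans m≡d d≡r^2) d≡r^2 ⟩
      r ^ 2 * r ^ 2  ≡⟨ ^-distribˡ-+-* r 2 2 ⟨
      r ^ 4          ∎))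
    m≢r : m ≢ r
    m≢r m≡r = ¬primePower (r , 3 , r-prime , trans n≡m*d (cong₂ _*_ m≡r d≡r^2))

  composite⇒neighbourFactors : ¬ IsPrimePower n → ¬ Prime d →
    ∃[ s ] ∃[ t ] NeighbourFactor m d s × NeighbourFactor m d t × s ≢ t
  composite⇒neighbourFactors ¬primePower ¬prime with primeDivisor 1<d
  ... | r , r-prime , r∣d = cases (m ≟ d) (m * r ≟ d)
    where
    1<r = prime⇒>1 r-prime
    instance
      r-nonTrivial = n>1⇒nonTrivial 1<r
      r≢0 = >-nonZero (<-trans z<s 1<r)
    r<d : r < d
    r<d = ≤∧≢⇒< (∣⇒≤ r∣d) (λ r≡d → ¬prime (subst Prime r≡d r-prime))
    b = quotient r∣d
    1<b = quotient>1 r∣d r<d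
    b≡r⇒d≡r*r : b ≡ r → d ≡ r * r
    b≡r⇒d≡r*r b≡r = trans (m∣n⇒n≡quotient*m r∣d) (cong (_* r) b≡r)
    b-factor : m * b ≢ d → NeighbourFactor m d b
    b-factor m*b≢d = quotient-∣ r∣d , quotient-< r∣d , m*b≢d
    1-factor : m ≢ d → NeighbourFactor m d 1
    1-factor m≢d = 1∣ d , 1<d , λ m*1≡d → m≢d (trans (sym (*-identityʳ m)) m*1≡d)

    cases : Dec (m ≡ d) → Dec (m * r ≡ d) → ∃[ s ] ∃[ t ] NeighbourFactor m d s × NeighbourFactor m d t × s ≢ t
    cases (yes m≡d) _ = r , b , (r∣d , r<d , m*t≢d 1<r) , b-factor (m*t≢d 1<b) , r≢b
      where
      m*t≢d : ∀ {t} → 1 < t → m * t ≢ d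
      m*t≢d {t} 1<t m*t≡d = <⇒≢ 1<t (sym (*-cancelˡ-≡ t 1 m (trans m*t≡d (trans (sym m≡d) (sym (*-identityʳ m))))))
      r≢b : r ≢ b
      r≢b r≡b = proj₁ (squareOfPrime-cofactor ¬primePower r-prime (b≡r⇒d≡r*r (sym r≡b))) m≡d
    cases (no m≢d) (yes m*r≡d) = 1 , b , 1-factor m≢d , b-factor m*b≢d , <⇒≢ 1<b
      where
      m*b≢d : m * b ≢ d
      m*b≢d m*b≡d = proj₂ (squareOfPrime-cofactor ¬primePower r-prime d≡r*r) (*-cancelʳ-≡ m r r (trans m*r≡d d≡r*r))
        where d≡r*r = b≡r⇒d≡r*r (*-cancelˡ-≡ b r m (trans m*b≡d (sym m*r≡d)))
    cases (no m≢d) (no m*r≢d) = 1 , r , 1-factor m≢d , (r∣d , r<d , m*r≢d) , <⇒≢ 1<r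

  composite-¬isPendant : ¬ IsPrimePower n → ¬ Prime d → ¬ IsPendant n d
  composite-¬isPendant ¬primePower ¬prime with composite⇒neighbourFactors ¬primePower ¬prime
  ... | s , t , s-factor , t-factor , s≢t = neighbourFactors⇒¬isPendant s-factor t-factor s≢t

pendants-¬IsPrimePower : 1 < n → ¬ IsPrimePower n → IsPendant n d ⇔ (Prime d × d ∣ n)
pendants-¬IsPrimePower {n} {d} 1<n ¬primePower = mk⇔ to from
  where
  to : IsPendant n d → Prime d × d ∣ n
  to (d-vertex , degree≡1) with prime? d
  ... | yes d-prime = d-prime , proj₂ (proj₂ d-vertex)
  ... | no ¬prime = contradiction (d-vertex , degree≡1) (Cofactor.composite-¬isPendant d-vertex ¬primePower ¬prime)

  from : Prime d × d ∣ n → IsPendant n d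
  from (d-prime , d∣n) = Cofactor.prime-isPendant (prime⇒>1 d-prime , d<n , d∣n) d-prime
    (λ n≡d*d → ¬primePower (d , 2 , d-prime , trans n≡d*d (square≡^2 d)))
    where
    d<n : d < n
    d<n = ≤∧≢⇒< (∣⇒≤ {{>-nonZero (<-trans z<s 1<n)}} d∣n)
                (λ d≡n → ¬primePower (d , 1 , d-prime , trans (sym d≡n) (sym (^-identityʳ d))))

proposition2p4 :
  ((p α : ℕ) → Prime p → (α ≡ 3 ⊎ α ≡ 4) →
    (d : ℕ) → IsPendant (p ^ α) d ⇔ (d ≡ p ⊎ d ≡ p ^ 2))
  × ((p α : ℕ) → Prime p → 5 ≤ α →
    (d : ℕ) → IsPendant (p ^ α) d ⇔ d ≡ p)
  × ((n : ℕ) → 1 < n →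
    (Σ[ p ∈ ℕ ] Σ[ q ∈ ℕ ] (Prime p × Prime q × p ≢ q × p ∣ n × q ∣ n)) →
    (d : ℕ) → IsPendant n d ⇔ (Prime d × d ∣ n))
proposition2p4 =
  (λ { p .3 p-prime (inj₁ refl) d → pendants-p^3 p-prime ; p .4 p-prime (inj₂ refl) d → pendants-p^4 p-prime }) ,
  (λ p α p-prime 5≤α d → pendants-p^≥5 p-prime 5≤α) ,
  λ { n 1<n (p , q , p-prime , q-prime , p≢q , p∣n , q∣n) d →
        pendants-¬IsPrimePower 1<n (distinctPrimeDivisors⇒¬IsPrimePower p-prime q-prime p≢q p∣n q∣n) }
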